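{- Let $t\ge 2$ and let $(i_1,\dots,i_t)$ be a permutation of $\{1,\dots,t\}$ with $|i_{t-1}-i_t|>1$. Then the labelled graphs $\mathscr G(c_{i_1}<c_{i_2}<\dots<c_{i_{t-2}}<c_{i_{t-1}}<c_{i_t})$ and $\mathscr G(c_{i_1}<c_{i_2}<\dots<c_{i_{t-2}}<c_{i_t}<c_{i_{t-1}})$ coincide, i.e. they are isomorphic via an isomorphism preserving all vertex and edge labels.
   Context: Let $T=\{1,\dots,t\}$. A linear order $\mathbf c$ on symbols $c_1,\dots,c_t$ (equivalently a strict total order on $T$) determines a labelled graph $\mathscr G(\mathbf c)$ (vertices labelled in $\{1,\dots,t+1\}$, edges labelled in $T$), defined inductively. For $t=1$: two vertices labelled $1$ and $2$ joined by an edge labelled $1$. For $t\ge2$: let $c_s$ be the maximal element of $\mathbf c$. Let $\mathbf c'$ be the induced order on $\mathbf c\setminus\{c_s\}$, reindexed by keeping indices $<s$ and decreasing indices $>s$ by $1$; let $\mathscr G'=\mathscr G(\mathbf c')$. Let $\mathscr G^+$ be a copy of $\mathscr G'$ in which every label (on vertices and edges) $\ell\le s-1$ is kept and every label $\ell\ge s$ is replaced by $\ell+1$. Let $\mathscr G^-$ be a second copy of the same underlying graph, with $\varphi:\mathscr G^+\to\mathscr G^-$ the identification, carrying the same labels except that vertices labelled $s+1$ in $\mathscr G^+$ are labelled $s$ in $\mathscr G^-$. Then $\mathscr G(\mathbf c)$ is the disjoint union of $\mathscr G^+$ and $\mathscr G^-$ together with, for each vertex $v$ of $\mathscr G^+$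 of label $s+1$, an edge labelled $s$ joining $v$ and $\varphi(v)$. -}

module Defs where

open import Data.Nat using (ℕ; zero; suc; _∸_; _<ᵇ_; _≡ᵇ_)
open import Data.Bool using (Bool; true; false; if_then_else_; _∧_)
import Data.Bool as Bool
open import Data.Maybe using (Maybe; just; nothing)
import Data.Maybe as Maybe
open import Data.Vec using (Vec; []; _∷_; last; init; map)
open import Data.Vec.Properties using (≡-dec)
open import Data.List using (List)
import Data.List as List
open import Relation.Nullary using (does)
open import Relation.Binary.PropositionalEquality using (_≡_)
open import Data.Product using (Σ; _×_)
open import Function.Bundles using (_↔_; Inverse)
open import Level using (0ℓ)

-- A labelled graph: a vertex set, a vertex labelling, and an edge
-- labelling: elab u v = just ℓ  iff  u and v are joined by an edge labelled ℓ
-- (nothing = no edge).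
record LGraph : Set₁ where
  field
    V    : Set
    vlab : V → ℕ
    elab : V → V → Maybe ℕ

open LGraph public

_≅_ : LGraph → LGraph → Set
G ≅ H = Σ (V G ↔ V H) λ e →
          (∀ v → vlab H (Inverse.to e v) ≡ vlab G v) ×
          (∀ u v → elab H (Inverse.to e u) (Inverse.to e v) ≡ elab G u v)

-- A linear order c_{i_1} < c_{i_2} < ... < c_{i_m} is represented by the
-- vector (i_1 , ... , i_m) of (1-based) indices, listed from smallest to largest.

reidx : ℕ → ℕ → ℕ
reidx s ℓ = if ℓ <ᵇ s then ℓ else ℓ ∸ 1

relabel : ℕ → ℕ → ℕ
relabel s ℓ = if ℓ <ᵇ s then ℓ else suc ℓ

_≟V_ : ∀ {m} (u v : Vec Bool m) → Bool
u ≟V v = does (≡-dec Bool._≟_ u v)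

-- Vertices of 𝒢(c) for an order of length m are bit strings Vec Bool m;
-- the leading bit says whether the vertex lies in 𝒢⁺ (true) or 𝒢⁻ (false).
-- (Length 0 is never used; it gives a dummy graph.)
vl : (m : ℕ) → Vec ℕ m → Vec Bool m → ℕ
vl zero c v = 0
vl (suc zero) c (false ∷ []) = 1
vl (suc zero) c (true ∷ []) = 2
vl (suc (suc n)) c (true ∷ v) =
  relabel (last c) (vl (suc n) (map (reidx (last c)) (init c)) v)
vl (suc (suc n)) c (false ∷ v) =
  let s = last c
      ℓ = relabel s (vl (suc n) (map (reidx s) (init c)) v)
  in if ℓ ≡ᵇ suc s then s else ℓ

el : (m : ℕ) → Vec ℕ m → Vec Bool m → Vec Bool m → Maybe ℕ
el zero c u v = nothing
el (suc zero) c (false ∷ []) (false ∷ []) = nothing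
el (suc zero) c (false ∷ []) (true ∷ []) = just 1
el (suc zero) c (true ∷ []) (false ∷ []) = just 1
el (suc zero) c (true ∷ []) (true ∷ []) = nothing
el (suc (suc n)) c (true ∷ u) (true ∷ v) =
  Maybe.map (relabel (last c)) (el (suc n) (map (reidx (last c)) (init c)) u v)
el (suc (suc n)) c (false ∷ u) (false ∷ v) =
  Maybe.map (relabel (last c)) (el (suc n) (map (reidx (last c)) (init c)) u v)
el (suc (suc n)) c (true ∷ u) (false ∷ v) =
  if (u ≟V v) ∧ (relabel (last c) (vl (suc n) (map (reidx (last c)) (init c)) u) ≡ᵇ suc (last c))
  then just (last c) else nothing
el (suc (suc n)) c (false ∷ u) (true ∷ v) =
  if (u ≟V v) ∧ (relabel (last c) (vl (suc n) (map (reidx (last c)) (init c)) v) ≡ᵇ suc (last c))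
  then just (last c) else nothing

𝒢 : (m : ℕ) → Vec ℕ m → LGraph
𝒢 m c = record { V = Vec Bool m ; vlab = vl m c ; elab = el m c }

module Submission where

open import Defs
open import Data.Nat using (ℕ; suc; _+_; _<_; ∣_-_∣)
open import Data.Vec using (Vec; []; _∷_; _++_; toList)
open import Data.List using (upTo)
import Data.List as List
open import Data.List.Relation.Binary.Permutation.Propositional using (_↭_)

open import Data.Nat using (zero; pred; _≤_; _∸_; _<ᵇ_; _≡ᵇ_; z≤n; s≤s; _<?_)
open import Data.Nat.Properties
  using (≤-refl; ≤-trans; <-trans; <⇒≤; ≤-total; n≤1+n; n<1+n; ≮⇒≥; <-≤-trans; +-comm;
         m≤n⇒∣m-n∣≡n∸m; ∣-∣-comm)
open import Data.Bool using (Bool; true; false; if_then_else_; _∧_)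
open import Data.Bool.Properties using (if-float)
open import Data.Maybe using (Maybe; just; nothing)
import Data.Maybe as Maybe
import Data.Maybe.Properties as Maybe
open import Data.Vec using (last; init; map; _∷ʳ_; cast)
open import Data.Vec.Properties using (init-∷ʳ; last-∷ʳ; map-∷ʳ; map-cong; map-∘; cast-is-id)
open import Data.List.Membership.Propositional using (_∈_)
open import Data.List.Relation.Binary.Permutation.Propositional.Properties using (∈-resp-↭)
open import Data.List.Relation.Unary.Any using (here; there)
open import Data.Product using (_,_)
open import Data.Sum using (inj₁; inj₂)
open import Data.Empty using (⊥; ⊥-elim)
open import Function.Base using (_∘′_)
open import Function.Bundles using (mk↔ₛ′)
open import Relation.Nullary using (yes; no)
open import Relation.Binary.PropositionalEquality
  using (_≡_; refl; sym; trans; cong; _≗_; subst; module ≡-Reasoning)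

-- Let c end in ..., a, b, so that b is maximal and a is maximal among the
-- remaining symbols.  Unfolding the definition of 𝒢 twice, 𝒢(c) arises from
-- 𝒢(d), d the order with a and b removed, by two doublings: first at threshold
-- a' = reidx b a (removing a), then at threshold b.  A vertex is a bit string
-- x ∷ y ∷ w, where x is the half of the outer doubling and y the half of the
-- inner one.  For the order ending in ..., b, a the doublings are at b' = reidx a b,
-- then at a, over the same d.  When |a - b| > 1 the two pairs of label shifts
-- commute (the record Exchangeable), and then x ∷ y ∷ w ↦ y ∷ x ∷ w preserves
-- all vertex and edge labels.
--
-- In the theorem the case t = 2
-- is impossible (a permutation of {1,2} has |a - b| = 1), and a length cast
-- identifies xs ++ a ∷ b ∷ [] with (xs ∷ʳ a) ∷ʳ b.

-- Shift thresholds in the two halves of a doubling at s: labels ≥ s move up in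
-- the half 𝒢⁺ (bit true), labels ≥ s + 1 move up in the half 𝒢⁻ (bit false).
threshold : ℕ → Bool → ℕ
threshold s true = s
threshold s false = suc s

threshold-≤ : ∀ s x → threshold s x ≤ suc s
threshold-≤ s true = n≤1+n s
threshold-≤ s false = ≤-refl

threshold-≥ : ∀ s x → s ≤ threshold s x
threshold-≥ s true = ≤-refl
threshold-≥ s false = n≤1+n s

threshold-pred : ∀ s x → pred (threshold (suc s) x) ≡ threshold s x
threshold-pred s true = refl
threshold-pred s false = refl

<ᵇ-true : ∀ {l s} → l < s → (l <ᵇ s) ≡ true
<ᵇ-true {zero} (s≤s _) = refl
<ᵇ-true {suc l} (s≤s (s≤s l<s)) = <ᵇ-true {l} (s≤s l<s)

<ᵇ-false : ∀ {l s} → s ≤ l → (l <ᵇ s) ≡ false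
<ᵇ-false {l} {zero} _ = refl
<ᵇ-false {suc l} {suc s} (s≤s s≤l) = <ᵇ-false {l} {s} s≤l

relabel-below : ∀ {s l} → l < s → relabel s l ≡ l
relabel-below l<s rewrite <ᵇ-true l<s = refl

relabel-above : ∀ {s l} → s ≤ l → relabel s l ≡ suc l
relabel-above s≤l rewrite <ᵇ-false s≤l = refl

reidx-below : ∀ {s l} → l < s → reidx s l ≡ l
reidx-below l<s rewrite <ᵇ-true l<s = refl

reidx-above : ∀ {s l} → s ≤ l → reidx s l ≡ pred l
reidx-above s≤l rewrite <ᵇ-false s≤l = refl

relabel-suc : ∀ s l → relabel (suc s) (suc l) ≡ suc (relabel s l)
relabel-suc s l with l <ᵇ s
... | true = refl
... | false = refl

relabel-hits-suc : ∀ s l → (relabel s l ≡ᵇ suc s) ≡ (l ≡ᵇ s)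
relabel-hits-suc zero l = refl
relabel-hits-suc (suc s) zero = refl
relabel-hits-suc (suc s) (suc l) rewrite relabel-suc s l = relabel-hits-suc s l

relabel-hits-below : ∀ {a s} → a < s → ∀ l → (relabel s l ≡ᵇ a) ≡ (l ≡ᵇ a)
relabel-hits-below {zero} {suc s} _ zero = refl
relabel-hits-below {zero} {suc s} _ (suc l) rewrite relabel-suc s l = refl
relabel-hits-below {suc a} {suc s} _ zero = refl
relabel-hits-below {suc a} {suc s} (s≤s a<s) (suc l) rewrite relabel-suc s l =
  relabel-hits-below a<s l

relabel-hits-above : ∀ {s B} → s ≤ B → ∀ l → (relabel s l ≡ᵇ suc B) ≡ (l ≡ᵇ B)
relabel-hits-above {zero} _ l = refl
relabel-hits-above {suc s} {suc B} _ zero = refl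
relabel-hits-above {suc s} {suc B} (s≤s s≤B) (suc l) rewrite relabel-suc s l =
  relabel-hits-above s≤B l

-- Relabelling at s and then sending s + 1 back to s is relabelling at s + 1:
-- this is the vertex labelling of the half 𝒢⁻.
relabel-fold : ∀ s l →
  (if relabel s l ≡ᵇ suc s then s else relabel s l) ≡ relabel (suc s) l
relabel-fold zero zero = refl
relabel-fold zero (suc l) = refl
relabel-fold (suc s) zero = refl
relabel-fold (suc s) (suc l) rewrite relabel-suc s l | relabel-suc (suc s) l
  with relabel s l ≡ᵇ suc s | relabel-fold s l
... | true | e = cong suc e
... | false | e = cong suc e

relabel-comm : ∀ {p q} → p < q → ∀ l →
  relabel q (relabel p l) ≡ relabel p (relabel (pred q) l)
relabel-comm {zero} {suc q} _ l = relabel-suc q l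
relabel-comm {suc p} {suc zero} (s≤s ()) l
relabel-comm {suc p} {suc (suc q)} _ zero = refl
relabel-comm {suc p} {suc (suc q)} (s≤s p<q) (suc l)
  rewrite relabel-suc p l | relabel-suc (suc q) (relabel p l)
        | relabel-suc q l | relabel-suc p (relabel q l) = cong suc (relabel-comm p<q l)

reidx-comm : ∀ {a B} → a < B → ∀ l → reidx a (reidx (suc B) l) ≡ reidx B (reidx a l)
reidx-comm {a} {B} a<B l with l <? a | l <? suc B
... | yes l<a | _ = begin
  reidx a (reidx (suc B) l) ≡⟨ cong (reidx a) (reidx-below (<-trans l<a (<-trans a<B (n<1+n B)))) ⟩
  reidx a l                 ≡⟨ reidx-below l<a ⟩
  l                         ≡⟨ sym (reidx-below (<-trans l<a a<B)) ⟩
  reidx B l                 ≡⟨ cong (reidx B) (sym (reidx-below l<a)) ⟩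
  reidx B (reidx a l)       ∎
  where open ≡-Reasoning
... | no l≮a | yes l≤B = begin
  reidx a (reidx (suc B) l) ≡⟨ cong (reidx a) (reidx-below l≤B) ⟩
  reidx a l                 ≡⟨ reidx-above (≮⇒≥ l≮a) ⟩
  pred l                    ≡⟨ sym (reidx-below (pred< l l≤B)) ⟩
  reidx B (pred l)          ≡⟨ cong (reidx B) (sym (reidx-above (≮⇒≥ l≮a))) ⟩
  reidx B (reidx a l)       ∎
  where
  open ≡-Reasoning
  pred< : ∀ l → l < suc B → pred l < B
  pred< zero _ = ≤-trans (s≤s z≤n) a<B
  pred< (suc l) (s≤s l<B) = l<B
... | no _ | no l≮B = above l (≮⇒≥ l≮B)
  where
  open ≡-Reasoning
  above : ∀ l → suc B ≤ l → reidx a (reidx (suc B) l) ≡ reidx B (reidx a l)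
  above (suc l) (s≤s B≤l) = begin
    reidx a (reidx (suc B) (suc l)) ≡⟨ cong (reidx a) (reidx-above (s≤s B≤l)) ⟩
    reidx a l                       ≡⟨ reidx-above (≤-trans (<⇒≤ a<B) B≤l) ⟩
    pred l                          ≡⟨ sym (reidx-above B≤l) ⟩
    reidx B l                       ≡⟨ cong (reidx B) (reidx-above a≤1+l) ⟨
    reidx B (reidx a (suc l))       ∎
    where a≤1+l = ≤-trans (<⇒≤ a<B) (≤-trans B≤l (n≤1+n l))

-- Conditions under which doubling at a' and then at b can be exchanged with
-- doubling at b' and then at a (a', b' being a, b reindexed after removing the
-- other symbol): the label shifts commute, the inner edge labels a' and b' are
-- carried to the outer ones a and b, a label equals a' exactly when its shift
-- by the other doubling equals a (and likewise for b', b), and the reindexings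
-- of the remaining symbols agree.
record Exchangeable (a b a' b' : ℕ) : Set where
  field
    shifts-commute : ∀ x y l →
      relabel (threshold b x) (relabel (threshold a' y) l) ≡
      relabel (threshold a y) (relabel (threshold b' x) l)
    edge-label₁ : relabel b a' ≡ a
    edge-label₂ : relabel a b' ≡ b
    bridge₁ : ∀ x l → (l ≡ᵇ a') ≡ (relabel (threshold b' x) l ≡ᵇ a)
    bridge₂ : ∀ y l → (l ≡ᵇ b') ≡ (relabel (threshold a' y) l ≡ᵇ b)
    reindex-commute : ∀ l → reidx a' (reidx b l) ≡ reidx b' (reidx a l)

Exchangeable-sym : ∀ {a b a' b'} → Exchangeable a b a' b' → Exchangeable b a b' a'
Exchangeable-sym X = record
  { shifts-commute = λ x y l → sym (shifts-commute y x l)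
  ; edge-label₁ = edge-label₂
  ; edge-label₂ = edge-label₁
  ; bridge₁ = bridge₂
  ; bridge₂ = bridge₁
  ; reindex-commute = λ l → sym (reindex-commute l)
  }
  where open Exchangeable X

-- For a < B the symbols a and B + 1 are exchangeable; after removing the other
-- symbol they become a and B.
exchangeable-apart : ∀ {a B} → a < B → Exchangeable a (suc B) a B
exchangeable-apart {a} {B} a<B = record
  { shifts-commute = λ x y l →
      subst (λ q → relabel (threshold (suc B) x) (relabel (threshold a y) l) ≡
                   relabel (threshold a y) (relabel q l))
            (threshold-pred B x) (relabel-comm (thresholds-ordered x y) l)
  ; edge-label₁ = relabel-below (≤-trans a<B (n≤1+n B))
  ; edge-label₂ = relabel-above (<⇒≤ a<B)
  ; bridge₁ = λ x l → sym (relabel-hits-below (<-≤-trans a<B (threshold-≥ B x)) l)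
  ; bridge₂ = λ y l → sym (relabel-hits-above (≤-trans (threshold-≤ a y) a<B) l)
  ; reindex-commute = reidx-comm a<B
  }
  where
  thresholds-ordered : ∀ x y → threshold a y < threshold (suc B) x
  thresholds-ordered x y = ≤-trans (s≤s (≤-trans (threshold-≤ a y) a<B)) (threshold-≥ (suc B) x)

exchangeable-ordered : ∀ a b → suc a < b → Exchangeable a b (reidx b a) (reidx a b)
exchangeable-ordered a (suc B) (s≤s a<B)
  rewrite reidx-below {suc B} {a} (≤-trans a<B (n≤1+n B))
        | reidx-above {a} {suc B} (≤-trans (<⇒≤ a<B) (n≤1+n B)) = exchangeable-apart a<B

gap⇒< : ∀ a b → 1 < b ∸ a → suc a < b
gap⇒< zero b 1<b = 1<b
gap⇒< (suc a) (suc b) 1<b∸a = s≤s (gap⇒< a b 1<b∸a)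

exchangeable : ∀ a b → 1 < ∣ a - b ∣ → Exchangeable a b (reidx b a) (reidx a b)
exchangeable a b gap with ≤-total a b
... | inj₁ a≤b rewrite m≤n⇒∣m-n∣≡n∸m a≤b = exchangeable-ordered a b (gap⇒< a b gap)
... | inj₂ b≤a rewrite ∣-∣-comm a b | m≤n⇒∣m-n∣≡n∸m b≤a =
  Exchangeable-sym (exchangeable-ordered b a (gap⇒< b a gap))

-- The doubling at threshold s of a graph on bit strings of length m with vertex
-- labels L and edge labels E: the half 𝒢⁺ (leading bit true) is relabelled at s,
-- the half 𝒢⁻ likewise except that label s + 1 becomes s, and each vertex of 𝒢⁺
-- of label s + 1 is joined to its copy in 𝒢⁻ by an edge labelled s.
doubleV : ∀ {m} → ℕ → (Vec Bool m → ℕ) → Vec Bool (suc m) → ℕ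
doubleV s L (true ∷ w) = relabel s (L w)
doubleV s L (false ∷ w) = if relabel s (L w) ≡ᵇ suc s then s else relabel s (L w)

doubleE : ∀ {m} → ℕ → (Vec Bool m → ℕ) → (Vec Bool m → Vec Bool m → Maybe ℕ) →
          Vec Bool (suc m) → Vec Bool (suc m) → Maybe ℕ
doubleE s L E (true ∷ u) (true ∷ v) = Maybe.map (relabel s) (E u v)
doubleE s L E (false ∷ u) (false ∷ v) = Maybe.map (relabel s) (E u v)
doubleE s L E (true ∷ u) (false ∷ v) =
  if (u ≟V v) ∧ (relabel s (L u) ≡ᵇ suc s) then just s else nothing
doubleE s L E (false ∷ u) (true ∷ v) =
  if (u ≟V v) ∧ (relabel s (L v) ≡ᵇ suc s) then just s else nothing

doubleV-threshold : ∀ {m} s (L : Vec Bool m → ℕ) x w →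
  doubleV s L (x ∷ w) ≡ relabel (threshold s x) (L w)
doubleV-threshold s L true w = refl
doubleV-threshold s L false w = relabel-fold s (L w)

doubleE-same-half : ∀ {m} s L (E : Vec Bool m → Vec Bool m → Maybe ℕ) x u v →
  doubleE s L E (x ∷ u) (x ∷ v) ≡ Maybe.map (relabel s) (E u v)
doubleE-same-half s L E true u v = refl
doubleE-same-half s L E false u v = refl

doubleV-cong : ∀ {m} s {L L' : Vec Bool m → ℕ} → L ≗ L' → doubleV s L ≗ doubleV s L'
doubleV-cong s L≗L' (true ∷ w) = cong (relabel s) (L≗L' w)
doubleV-cong s L≗L' (false ∷ w) rewrite L≗L' w = refl

doubleE-cong : ∀ {m} s {L L' : Vec Bool m → ℕ} {E E' : Vec Bool m → Vec Bool m → Maybe ℕ} →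
  L ≗ L' → (∀ u v → E u v ≡ E' u v) → ∀ u v → doubleE s L E u v ≡ doubleE s L' E' u v
doubleE-cong s L≗L' E≡E' (true ∷ u) (true ∷ v) = cong (Maybe.map (relabel s)) (E≡E' u v)
doubleE-cong s L≗L' E≡E' (false ∷ u) (false ∷ v) = cong (Maybe.map (relabel s)) (E≡E' u v)
doubleE-cong s L≗L' E≡E' (true ∷ u) (false ∷ v) rewrite L≗L' u = refl
doubleE-cong s L≗L' E≡E' (false ∷ u) (true ∷ v) rewrite L≗L' v = refl

reduce : ∀ {k} → Vec ℕ (suc (suc k)) → Vec ℕ (suc k)
reduce c = map (reidx (last c)) (init c)

vl-double : ∀ {k} (c : Vec ℕ (suc (suc k))) →
  vl (suc (suc k)) c ≗ doubleV (last c) (vl (suc k) (reduce c))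
vl-double c (true ∷ w) = refl
vl-double c (false ∷ w) = refl

el-double : ∀ {k} (c : Vec ℕ (suc (suc k))) u v →
  el (suc (suc k)) c u v ≡ doubleE (last c) (vl (suc k) (reduce c)) (el (suc k) (reduce c)) u v
el-double c (true ∷ u) (true ∷ v) = refl
el-double c (true ∷ u) (false ∷ v) = refl
el-double c (false ∷ u) (true ∷ v) = refl
el-double c (false ∷ u) (false ∷ v) = refl

vl-double² : ∀ {j} (c : Vec ℕ (suc (suc (suc j)))) {s s' d} →
  last c ≡ s → last (reduce c) ≡ s' → reduce (reduce c) ≡ d →
  vl (suc (suc (suc j))) c ≗ doubleV s (doubleV s' (vl (suc j) d))
vl-double² c refl refl refl v =
  trans (vl-double c v) (doubleV-cong (last c) (vl-double (reduce c)) v)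

el-double² : ∀ {j} (c : Vec ℕ (suc (suc (suc j)))) {s s' d} →
  last c ≡ s → last (reduce c) ≡ s' → reduce (reduce c) ≡ d → ∀ u v →
  el (suc (suc (suc j))) c u v ≡
  doubleE s (doubleV s' (vl (suc j) d)) (doubleE s' (vl (suc j) d) (el (suc j) d)) u v
el-double² c refl refl refl u v =
  trans (el-double c u v) (doubleE-cong (last c) (vl-double (reduce c)) (el-double (reduce c)) u v)

swap : ∀ {m} → Vec Bool (suc (suc m)) → Vec Bool (suc (suc m))
swap (x ∷ y ∷ w) = y ∷ x ∷ w

swap-involutive : ∀ {m} (v : Vec Bool (suc (suc m))) → swap (swap v) ≡ v
swap-involutive (x ∷ y ∷ w) = refl

≟V-∷ : ∀ {m} x (u v : Vec Bool m) → ((x ∷ u) ≟V (x ∷ v)) ≡ (u ≟V v)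
≟V-∷ true u v = refl
≟V-∷ false u v = refl

shift-cross-edge : ∀ (f : ℕ → ℕ) q {p p' s t} → p ≡ p' → f s ≡ t →
  Maybe.map f (if q ∧ p then just s else nothing) ≡ (if q ∧ p' then just t else nothing)
shift-cross-edge f q refl refl = if-float (Maybe.map f) (q ∧ _)

module Exchange {a b a' b'} (X : Exchangeable a b a' b') {m}
                (L : Vec Bool m → ℕ) (E : Vec Bool m → Vec Bool m → Maybe ℕ) where
  open Exchangeable X

  -- (L₁, E₁) is the shape of 𝒢 for an order ending in a, b and (L₂, E₂) for
  -- one ending in b, a, over the same remaining order with graph (L, E).
  L₁ L₂ : Vec Bool (suc (suc m)) → ℕ
  L₁ = doubleV b (doubleV a' L)
  L₂ = doubleV a (doubleV b' L)

  E₁ E₂ : Vec Bool (suc (suc m)) → Vec Bool (suc (suc m)) → Maybe ℕ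
  E₁ = doubleE b (doubleV a' L) (doubleE a' L E)
  E₂ = doubleE a (doubleV b' L) (doubleE b' L E)

  -- The swap preserves vertex labels, since the label shifts commute.
  vertex-exchange : ∀ v → L₂ (swap v) ≡ L₁ v
  vertex-exchange (x ∷ y ∷ w) = begin
    L₂ (y ∷ x ∷ w)
      ≡⟨ doubleV-threshold a _ y (x ∷ w) ⟩
    relabel (threshold a y) (doubleV b' L (x ∷ w))
      ≡⟨ cong (relabel (threshold a y)) (doubleV-threshold b' L x w) ⟩
    relabel (threshold a y) (relabel (threshold b' x) (L w))
      ≡⟨ shifts-commute x y (L w) ⟨
    relabel (threshold b x) (relabel (threshold a' y) (L w))
      ≡⟨ cong (relabel (threshold b x)) (doubleV-threshold a' L y w) ⟨
    relabel (threshold b x) (doubleV a' L (y ∷ w))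
      ≡⟨ doubleV-threshold b _ x (y ∷ w) ⟨
    L₁ (x ∷ y ∷ w)
      ∎
    where open ≡-Reasoning

  same-halves : ∀ x y u v → E₂ (y ∷ x ∷ u) (y ∷ x ∷ v) ≡ E₁ (x ∷ y ∷ u) (x ∷ y ∷ v)
  same-halves x y u v = begin
    E₂ (y ∷ x ∷ u) (y ∷ x ∷ v)
      ≡⟨ doubleE-same-half a _ _ y (x ∷ u) (x ∷ v) ⟩
    Maybe.map (relabel a) (doubleE b' L E (x ∷ u) (x ∷ v))
      ≡⟨ cong (Maybe.map (relabel a)) (doubleE-same-half b' L E x u v) ⟩
    Maybe.map (relabel a) (Maybe.map (relabel b') (E u v))
      ≡⟨ Maybe.map-∘ (E u v) ⟨
    Maybe.map (relabel a ∘′ relabel b') (E u v)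
      ≡⟨ Maybe.map-cong (λ l → sym (shifts-commute true true l)) (E u v) ⟩
    Maybe.map (relabel b ∘′ relabel a') (E u v)
      ≡⟨ Maybe.map-∘ (E u v) ⟩
    Maybe.map (relabel b) (Maybe.map (relabel a') (E u v))
      ≡⟨ cong (Maybe.map (relabel b)) (doubleE-same-half a' L E y u v) ⟨
    Maybe.map (relabel b) (doubleE a' L E (y ∷ u) (y ∷ v))
      ≡⟨ doubleE-same-half b _ _ x (y ∷ u) (y ∷ v) ⟨
    E₁ (x ∷ y ∷ u) (x ∷ y ∷ v)
      ∎
    where open ≡-Reasoning

  bridge-condition : ∀ x w →
    (relabel a' (L w) ≡ᵇ suc a') ≡ (relabel a (doubleV b' L (x ∷ w)) ≡ᵇ suc a)
  bridge-condition x w = begin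
    relabel a' (L w) ≡ᵇ suc a'                          ≡⟨ relabel-hits-suc a' (L w) ⟩
    L w ≡ᵇ a'                                           ≡⟨ bridge₁ x (L w) ⟩
    relabel (threshold b' x) (L w) ≡ᵇ a                 ≡⟨ relabel-hits-suc a _ ⟨
    relabel a (relabel (threshold b' x) (L w)) ≡ᵇ suc a
      ≡⟨ cong (λ l → relabel a l ≡ᵇ suc a) (doubleV-threshold b' L x w) ⟨
    relabel a (doubleV b' L (x ∷ w)) ≡ᵇ suc a           ∎
    where open ≡-Reasoning

  inner-cross : ∀ x u v →
    E₂ (true ∷ x ∷ u) (false ∷ x ∷ v) ≡ E₁ (x ∷ true ∷ u) (x ∷ false ∷ v)
  inner-cross x u v
    rewrite ≟V-∷ x u v
          | doubleE-same-half b (doubleV a' L) (doubleE a' L E) x (true ∷ u) (false ∷ v) =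
    sym (shift-cross-edge (relabel b) (u ≟V v) (bridge-condition x u) edge-label₁)

  inner-cross′ : ∀ x u v →
    E₂ (false ∷ x ∷ u) (true ∷ x ∷ v) ≡ E₁ (x ∷ false ∷ u) (x ∷ true ∷ v)
  inner-cross′ x u v
    rewrite ≟V-∷ x u v
          | doubleE-same-half b (doubleV a' L) (doubleE a' L E) x (false ∷ u) (true ∷ v) =
    sym (shift-cross-edge (relabel b) (u ≟V v) (bridge-condition x v) edge-label₁)

-- The
-- cross edges of the outer doublings are the inner cross edges of the exchanged
-- situation, whose iterated doublings are the same two with roles reversed.
edge-exchange : ∀ {a b a' b'} (X : Exchangeable a b a' b') {m} L E
  (u v : Vec Bool (suc (suc m))) →
  Exchange.E₂ X L E (swap u) (swap v) ≡ Exchange.E₁ X L E u v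
edge-exchange X L E (x ∷ y ∷ u) (x' ∷ y' ∷ v) = by-halves x y x' y'
  where
  open Exchange X L E
  module Reversed = Exchange (Exchangeable-sym X) L E

  by-halves : ∀ x y x' y' →
    E₂ (y ∷ x ∷ u) (y' ∷ x' ∷ v) ≡ E₁ (x ∷ y ∷ u) (x' ∷ y' ∷ v)
  by-halves true  true  true  true  = same-halves true true u v
  by-halves true  false true  false = same-halves true false u v
  by-halves false true  false true  = same-halves false true u v
  by-halves false false false false = same-halves false false u v
  by-halves true  true  true  false = inner-cross true u v
  by-halves false true  false false = inner-cross false u v
  by-halves true  false true  true  = inner-cross′ true u v
  by-halves false false false true  = inner-cross′ false u v
  by-halves true  true  false true  = sym (Reversed.inner-cross true u v)
  by-halves true  false false false = sym (Reversed.inner-cross false u v)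
  by-halves false true  true  true  = sym (Reversed.inner-cross′ true u v)
  by-halves false false true  false = sym (Reversed.inner-cross′ false u v)
  by-halves true  true  false false = refl
  by-halves true  false false true  = refl
  by-halves false true  true  false = refl
  by-halves false false true  true  = refl

swap-iso : ∀ {j} (c₁ c₂ : Vec ℕ (suc (suc (suc j)))) {a b a' b'} → Exchangeable a b a' b' →
  last c₁ ≡ b → last (reduce c₁) ≡ a' → last c₂ ≡ a → last (reduce c₂) ≡ b' →
  reduce (reduce c₂) ≡ reduce (reduce c₁) →
  𝒢 (suc (suc (suc j))) c₁ ≅ 𝒢 (suc (suc (suc j))) c₂
swap-iso {j} c₁ c₂ X b-last a'-last a-last b'-last same-rest =
  mk↔ₛ′ swap swap swap-involutive swap-involutive , vertices , edges
  where
  d : Vec ℕ (suc j)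
  d = reduce (reduce c₁)
  open Exchange X (vl (suc j) d) (el (suc j) d)

  vertices : ∀ v → vl _ c₂ (swap v) ≡ vl _ c₁ v
  vertices v = begin
    vl _ c₂ (swap v) ≡⟨ vl-double² c₂ a-last b'-last same-rest (swap v) ⟩
    L₂ (swap v)      ≡⟨ vertex-exchange v ⟩
    L₁ v             ≡⟨ vl-double² c₁ b-last a'-last refl v ⟨
    vl _ c₁ v        ∎
    where open ≡-Reasoning

  edges : ∀ u v → el _ c₂ (swap u) (swap v) ≡ el _ c₁ u v
  edges u v = begin
    el _ c₂ (swap u) (swap v) ≡⟨ el-double² c₂ a-last b'-last same-rest (swap u) (swap v) ⟩
    E₂ (swap u) (swap v)      ≡⟨ edge-exchange X (vl (suc j) d) (el (suc j) d) u v ⟩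
    E₁ u v                    ≡⟨ el-double² c₁ b-last a'-last refl u v ⟨
    el _ c₁ u v               ∎
    where open ≡-Reasoning

reduce-∷ʳ : ∀ {k} (cs : Vec ℕ (suc k)) b → reduce (cs ∷ʳ b) ≡ map (reidx b) cs
reduce-∷ʳ cs b rewrite last-∷ʳ b cs | init-∷ʳ b cs = refl

-- The theorem for orders of at least three symbols, written with _∷ʳ_; only the
-- gap between a and b is needed, not that the symbols form a permutation.
exchange-last-two : ∀ {j} (xs : Vec ℕ (suc j)) a b → 1 < ∣ a - b ∣ →
  𝒢 (suc (suc (suc j))) ((xs ∷ʳ a) ∷ʳ b) ≅ 𝒢 (suc (suc (suc j))) ((xs ∷ʳ b) ∷ʳ a)
exchange-last-two xs a b gap =
  swap-iso ((xs ∷ʳ a) ∷ʳ b) ((xs ∷ʳ b) ∷ʳ a) X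
    (last-∷ʳ b (xs ∷ʳ a)) (last-reduce a b) (last-∷ʳ a (xs ∷ʳ b)) (last-reduce b a) same-rest
  where
  X : Exchangeable a b (reidx b a) (reidx a b)
  X = exchangeable a b gap
  open Exchangeable X using (reindex-commute)
  open ≡-Reasoning

  reduce¹ : ∀ p q → reduce ((xs ∷ʳ p) ∷ʳ q) ≡ map (reidx q) xs ∷ʳ reidx q p
  reduce¹ p q = trans (reduce-∷ʳ (xs ∷ʳ p) q) (map-∷ʳ (reidx q) p xs)

  last-reduce : ∀ p q → last (reduce ((xs ∷ʳ p) ∷ʳ q)) ≡ reidx q p
  last-reduce p q = trans (cong last (reduce¹ p q)) (last-∷ʳ (reidx q p) (map (reidx q) xs))

  reduce² : ∀ p q → reduce (reduce ((xs ∷ʳ p) ∷ʳ q)) ≡ map (reidx (reidx q p)) (map (reidx q) xs)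
  reduce² p q = trans (cong reduce (reduce¹ p q)) (reduce-∷ʳ (map (reidx q) xs) (reidx q p))

  same-rest : reduce (reduce ((xs ∷ʳ b) ∷ʳ a)) ≡ reduce (reduce ((xs ∷ʳ a) ∷ʳ b))
  same-rest = begin
    reduce (reduce ((xs ∷ʳ b) ∷ʳ a))           ≡⟨ reduce² b a ⟩
    map (reidx (reidx a b)) (map (reidx a) xs) ≡⟨ map-∘ _ _ xs ⟨
    map (reidx (reidx a b) ∘′ reidx a) xs      ≡⟨ map-cong (λ l → sym (reindex-commute l)) xs ⟩
    map (reidx (reidx b a) ∘′ reidx b) xs      ≡⟨ map-∘ _ _ xs ⟩
    map (reidx (reidx b a)) (map (reidx b) xs) ≡⟨ reduce² a b ⟨
    reduce (reduce ((xs ∷ʳ a) ∷ʳ b))           ∎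

cast-++-pair : ∀ {n} .(e : n + 2 ≡ suc (suc n)) (xs : Vec ℕ n) a b →
  cast e (xs ++ a ∷ b ∷ []) ≡ (xs ∷ʳ a) ∷ʳ b
cast-++-pair e [] a b = refl
cast-++-pair e (x ∷ xs) a b = cong (x ∷_) (cast-++-pair _ xs a b)

≅-cast : ∀ {m m'} (e : m ≡ m') {c₁ c₂ : Vec ℕ m} {d₁ d₂ : Vec ℕ m'} →
  cast e c₁ ≡ d₁ → cast e c₂ ≡ d₂ → 𝒢 m' d₁ ≅ 𝒢 m' d₂ → 𝒢 m c₁ ≅ 𝒢 m c₂
≅-cast refl {c₁} {c₂} refl refl iso rewrite cast-is-id refl c₁ | cast-is-id refl c₂ = iso

symbols-of-pair-adjacent : ∀ {a b} →
  a ∈ (1 List.∷ 2 List.∷ List.[]) → b ∈ (1 List.∷ 2 List.∷ List.[]) → 1 < ∣ a - b ∣ → ⊥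
symbols-of-pair-adjacent (here refl) (here refl) ()
symbols-of-pair-adjacent (here refl) (there (here refl)) (s≤s ())
symbols-of-pair-adjacent (there (here refl)) (here refl) (s≤s ())
symbols-of-pair-adjacent (there (here refl)) (there (here refl)) ()

lemma5p6p3 : (n : ℕ) (xs : Vec ℕ n) (a b : ℕ) →
    toList (xs ++ a ∷ b ∷ []) ↭ List.map suc (upTo (n + 2)) →
    1 < ∣ a - b ∣ →
    𝒢 (n + 2) (xs ++ a ∷ b ∷ []) ≅ 𝒢 (n + 2) (xs ++ b ∷ a ∷ [])
lemma5p6p3 zero [] a b perm gap =
  ⊥-elim (symbols-of-pair-adjacent (∈-resp-↭ perm (here refl))
                                   (∈-resp-↭ perm (there (here refl))) gap)
lemma5p6p3 (suc j) xs a b perm gap =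
  ≅-cast (+-comm (suc j) 2) (cast-++-pair _ xs a b) (cast-++-pair _ xs b a)
         (exchange-last-two xs a b gap)
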